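{- Let $\Delta\ge 1$ and $0\le\lambda<1$. Let $T$ be a rooted tree on $n$ vertices with $\Delta(T)\le\Delta$. Then there is a subtree $Q$ of $T$ containing the root with $|Q|\in[(1-2\lambda)n,(1-\lambda)n+2\Delta]$ such that $T\setminus Q$ has at most $\Delta$ connected components, each of order at most $\lambda n$.
   Context: $T\setminus Q$ denotes the graph with edge set $E(T)\setminus E(Q)$ and with isolated vertices deleted. $|Q|$ denotes the number of vertices of $Q$.
   Formalization: The parameter λ is taken rational. -}

module Defs where

open import Data.Nat using (ℕ; zero; suc; _+_; _*_)
open import Data.Fin using (Fin; zero; suc; _≟_)
open import Data.Bool using (Bool; true; false; T; _∧_; not; if_then_else_)
open import Data.List using (List; []; _∷_; length; _∷ʳ_)
open import Data.List.Relation.Unary.Unique.Propositional using (Unique)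
open import Data.List.Relation.Unary.Linked using (Linked)
open import Data.Product using (Σ; _×_; ∃; ∃-syntax)
open import Relation.Nullary using (¬_)
open import Relation.Nullary.Decidable using (⌊_⌋)
open import Relation.Binary.PropositionalEquality using (_≡_)
open import Function.Bundles using (_⇔_)
open import Data.Rational as ℚ using (ℚ; _/_)
import Data.Integer as ℤ

Rel₂ : ℕ → Set
Rel₂ n = Fin n → Fin n → Bool

VSet : ℕ → Set
VSet n = Fin n → Bool

count : ∀ {n} → VSet n → ℕ
count {zero}  f = 0
count {suc n} f = (if f zero then 1 else 0) + count (λ i → f (suc i))

data Walk {n : ℕ} (E : Rel₂ n) : Fin n → Fin n → Set where
  here : ∀ v → Walk E v v
  step : ∀ {u v w} → T (E u v) → Walk E v w → Walk E u w

HasCycle : ∀ {n} → Rel₂ n → Set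
HasCycle {n} E = ∃[ v ] ∃[ ws ]
  (2 Data.Nat.≤ length ws × Unique (v ∷ ws) × Linked (λ a b → T (E a b)) ((v ∷ ws) ∷ʳ v))

Symmetric : ∀ {n} → Rel₂ n → Set
Symmetric E = ∀ u v → T (E u v) → T (E v u)

Irreflexive : ∀ {n} → Rel₂ n → Set
Irreflexive E = ∀ v → ¬ T (E v v)

-- (V , E) is a tree: connected on V and acyclic (E is assumed to live on V)
IsTreeOn : ∀ {n} → VSet n → Rel₂ n → Set
IsTreeOn V E = (∀ u v → T (V u) → T (V v) → Walk E u v) × ¬ HasCycle E

record RootedTree (n : ℕ) : Set where
  field
    E      : Rel₂ n
    sym    : Symmetric E
    irrefl : Irreflexive E
    tree   : IsTreeOn (λ _ → true) E
    root   : Fin n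

degree : ∀ {n} → Rel₂ n → Fin n → ℕ
degree E v = count (E v)

MaxDegree≤ : ∀ {n} → Rel₂ n → ℕ → Set
MaxDegree≤ E Δ = ∀ v → degree E v Data.Nat.≤ Δ

record Subtree {n : ℕ} (Tr : RootedTree n) : Set where
  open RootedTree Tr
  field
    VQ       : VSet n
    EQ       : Rel₂ n
    EQ⊆E     : ∀ u v → T (EQ u v) → T (E u v)
    EQ-sym   : Symmetric EQ
    EQ-ends  : ∀ u v → T (EQ u v) → T (VQ u) × T (VQ v)
    isTree   : IsTreeOn VQ EQ
    hasRoot  : T (VQ root)

-- T ∖ Q : edges of T not in Q, isolated vertices deleted
diffE : ∀ {n} → Rel₂ n → Rel₂ n → Rel₂ n
diffE E EQ u v = E u v ∧ not (EQ u v)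

anyV : ∀ {n} → VSet n → Bool
anyV {zero}  f = false
anyV {suc n} f = if f zero then true else anyV (λ i → f (suc i))

diffV : ∀ {n} → Rel₂ n → VSet n
diffV E v = anyV (E v)

ℕ→ℚ : ℕ → ℚ
ℕ→ℚ m = ℤ.+ m / 1

-- the graph (V , E) has at most Δ connected components, each with at most
-- λ·n vertices: a labelling of its vertices by at most Δ labels where two
-- vertices get the same label iff they are joined by a walk, and each label
-- class has at most λ·n vertices.
FewSmallComponents : ∀ {n} → VSet n → Rel₂ n → ℕ → ℚ → Set
FewSmallComponents {n} V E Δ bound =
  ∃[ k ] (k Data.Nat.≤ Δ × Σ (Fin n → Fin k) λ f →
    (∀ u v → T (V u) → T (V v) → ((f u ≡ f v) ⇔ Walk E u v)) ×
    (∀ i → ℕ→ℚ (count (λ v → V v ∧ ⌊ f v ≟ i ⌋)) ℚ.≤ bound))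

module Submission where

-- Let L = λn. Choose a vertex v whose subtree has more than L vertices but is minimal with this
-- property, so that the subtree at every child of v has at most L vertices. As v has at most Δ
-- children, the proper subtrees of its children together contain at least L - 2Δ vertices. Going
-- through the children c₁, c₂, … of v, stop at the first j for which the proper subtrees of
-- c₁, …, cⱼ contain at least L - 2Δ vertices; each contributes at most L, so they contain at most
-- 2L. Deleting these proper subtrees leaves a subtree Q containing the root (the cᵢ stay in Q), and
-- T ∖ Q is the disjoint union of the subtrees at c₁, …, cⱼ: at most Δ components, each with at
-- most L vertices, while n - |Q| lies in [L - 2Δ, 2L].

open import Defs
open import Data.Nat using (ℕ; suc)
open import Data.Fin using (Fin)
open import Data.List using (List)
open import Data.List.Membership.Propositional using (_∈_)
open import Data.List.Relation.Unary.Unique.Propositional using (Unique)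
open import Data.Rational as ℚ using (ℚ; 0ℚ)
import Data.Rational.Properties as ℚ

module FiniteCounting where
  open import Data.Nat using (zero; _+_; _≤_; z≤n; s≤s)
  open import Data.Nat.Properties using (+-mono-≤; +-suc; ≤-refl; ≤-trans; ≤-pred; ≮⇒≥; _<?_; module ≤-Reasoning)
  open import Data.Nat.ListAction using (sum)
  open import Data.Fin using (zero; suc; _≟_)
  open import Data.Fin.Properties using (any?)
  open import Data.Bool using (true; false; T; _∧_; _∨_; not; if_then_else_)
  open import Data.Bool.Properties using (T-∧; T-≡; ∧-identityʳ)
  open import Data.Bool.ListAction using (any)
  open import Data.List using ([]; _∷_; length; map)
  open import Data.List.Relation.Unary.All as All using (All; []; _∷_)
  open import Data.List.Relation.Unary.Any using (here; there)
  open import Data.List.Relation.Unary.Any.Properties using (any⁻)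
  open import Data.List.Relation.Unary.AllPairs using ([]; _∷_)
  open import Data.List.Membership.Propositional using (find)
  open import Data.Unit using (tt)
  open import Data.Empty using (⊥-elim)
  open import Data.Product using (∃; _,_; _×_; proj₂)
  open import Function using (_∘_)
  open import Function.Bundles using (_⇔_; mk⇔; Equivalence)
  open import Relation.Nullary using (¬_; yes; no; contradiction)
  open import Relation.Nullary.Decidable using (⌊_⌋; _×-dec_; ⌊⌋-map′; T?)
  open import Data.Sum using (_⊎_; inj₁; inj₂)
  open import Relation.Unary using (Decidable)
  open import Relation.Binary.PropositionalEquality using (_≡_; _≢_; refl; sym; trans; cong; cong₂; module ≡-Reasoning)

  private variable
    n : ℕ

  T-⇔⇒≡ : ∀ {x y} → (T x ⇔ T y) → x ≡ y
  T-⇔⇒≡ {false} {false} _ = refl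
  T-⇔⇒≡ {false} {true}  e = ⊥-elim (Equivalence.from e tt)
  T-⇔⇒≡ {true}  {false} e = ⊥-elim (Equivalence.to e tt)
  T-⇔⇒≡ {true}  {true}  _ = refl

  T-not : ∀ {x} → T (not x) ⇔ (¬ T x)
  T-not {false} = mk⇔ (λ _ ()) (λ _ → tt)
  T-not {true}  = mk⇔ (λ ()) (λ ¬t → ¬t tt)

  count-cong : {f g : VSet n} → (∀ i → f i ≡ g i) → count f ≡ count g
  count-cong {zero}  _ = refl
  count-cong {suc n} f≗g = cong₂ _+_ (cong (λ b → if b then 1 else 0) (f≗g zero)) (count-cong (f≗g ∘ suc))

  count-mono : {f g : VSet n} → (∀ i → T (f i) → T (g i)) → count f ≤ count g
  count-mono {zero}  _ = z≤n
  count-mono {suc n} {f} {g} f⊆g = +-mono-≤ (head (f zero) (g zero) (f⊆g zero)) (count-mono (f⊆g ∘ suc))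
    where
    head : ∀ a b → (T a → T b) → (if a then 1 else 0) ≤ (if b then 1 else 0)
    head false _     _   = z≤n
    head true  true  _   = ≤-refl
    head true  false a⇒b = ⊥-elim (a⇒b tt)

  count-none : {f : VSet n} → (∀ i → ¬ T (f i)) → count f ≡ 0
  count-none {zero}  _ = refl
  count-none {suc n} {f} none with f zero in eq
  ... | true  = ⊥-elim (none zero (Equivalence.from T-≡ eq))
  ... | false = count-none (none ∘ suc)

  count-all : {f : VSet n} → (∀ i → T (f i)) → count f ≡ n
  count-all {zero}  _ = refl
  count-all {suc n} {f} all with f zero | all zero
  ... | true | _ = cong suc (count-all (all ∘ suc))

  count-∨ : {f g : VSet n} → (∀ i → T (f i) → ¬ T (g i)) → count (λ i → f i ∨ g i) ≡ count f + count g
  count-∨ {zero}  _ = refl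
  count-∨ {suc n} {f} {g} disjoint with f zero in ef | g zero in eg
  ... | true  | true  = ⊥-elim (disjoint zero (Equivalence.from T-≡ ef) (Equivalence.from T-≡ eg))
  ... | true  | false = cong suc (count-∨ (disjoint ∘ suc))
  ... | false | true  = trans (cong suc (count-∨ (disjoint ∘ suc))) (sym (+-suc _ _))
  ... | false | false = count-∨ (disjoint ∘ suc)

  count-not : (f : VSet n) → count (not ∘ f) + count f ≡ n
  count-not {zero}  f = refl
  count-not {suc n} f with f zero
  ... | true  = trans (+-suc _ _) (cong suc (count-not (f ∘ suc)))
  ... | false = cong suc (count-not (f ∘ suc))

  count-≟ : (x : Fin n) → count (λ i → ⌊ i ≟ x ⌋) ≡ 1
  count-≟ {suc n} zero    = cong suc (count-none {n} λ _ ())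
  count-≟ {suc n} (suc x) = trans (count-cong λ i → ⌊⌋-map′ _ _ (i ≟ x)) (count-≟ x)

  count-remove : {f : VSet n} (x : Fin n) → T (f x) → count f ≡ suc (count (λ i → f i ∧ not ⌊ i ≟ x ⌋))
  count-remove {f = f} x fx = begin
    count f                              ≡⟨ count-cong split ⟩
    count (λ i → ⌊ i ≟ x ⌋ ∨ f∖x i)      ≡⟨ count-∨ disjoint ⟩
    count (λ i → ⌊ i ≟ x ⌋) + count f∖x  ≡⟨ cong (_+ count f∖x) (count-≟ x) ⟩
    suc (count f∖x)                      ∎
    where
    open ≡-Reasoning
    f∖x : VSet _
    f∖x i = f i ∧ not ⌊ i ≟ x ⌋
    split : ∀ i → f i ≡ (⌊ i ≟ x ⌋ ∨ f∖x i)
    split i with i ≟ x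
    ... | yes refl = Equivalence.to T-≡ fx
    ... | no _     = sym (∧-identityʳ (f i))
    disjoint : ∀ i → T ⌊ i ≟ x ⌋ → ¬ T (f∖x i)
    disjoint i with i ≟ x
    ... | yes _ = λ _ t → proj₂ (Equivalence.to T-∧ t)

  count-any : {A : Set} (g : A → VSet n) {cs : List A} → Unique cs →
    (∀ {c c′ w} → c ∈ cs → c′ ∈ cs → T (g c w) → T (g c′ w) → c ≡ c′) →
    count (λ w → any (λ c → g c w) cs) ≡ sum (map (count ∘ g) cs)
  count-any {n} g {[]} _ _ = count-none {n} λ _ ()
  count-any g {c ∷ cs} (c∉cs ∷ unique) disjoint =
    trans (count-∨ separate) (cong (count (g c) +_) (count-any g unique λ m m′ → disjoint (there m) (there m′)))
    where
    separate : ∀ w → T (g c w) → ¬ T (any (λ c → g c w) cs)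
    separate w gcw t with find (any⁻ _ cs t)
    ... | c′ , c′∈cs , gc′w = All.lookup c∉cs c′∈cs (disjoint (here refl) (there c′∈cs) gcw gc′w)

  length≤count : {f : VSet n} {xs : List (Fin n)} → Unique xs → All (T ∘ f) xs → length xs ≤ count f
  length≤count {xs = []}              _                 _          = z≤n
  length≤count {f = f} {xs = x ∷ xs} (x∉xs ∷ unique) (fx ∷ fxs) = begin
    suc (length xs)                         ≤⟨ s≤s (length≤count unique (All.zipWith keep (fxs , x∉xs))) ⟩
    suc (count (λ i → f i ∧ not ⌊ i ≟ x ⌋)) ≡⟨ count-remove x fx ⟨
    count f                                 ∎
    where
    open ≤-Reasoning
    keep : ∀ {y} → T (f y) × x ≢ y → T (f y ∧ not ⌊ y ≟ x ⌋)
    keep {y} (fy , x≢y) with y ≟ x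
    ... | yes refl = contradiction refl x≢y
    ... | no _     = Equivalence.from T-∧ (fy , tt)

  count≡0-or-witness : (f : VSet n) → count f ≡ 0 ⊎ ∃ (T ∘ f)
  count≡0-or-witness f with any? (T? ∘ f)
  ... | yes witness = inj₂ witness
  ... | no  none    = inj₁ (count-none λ x fx → none (x , fx))

  anyV-witness : {f : VSet n} → T (anyV f) → ∃ λ x → T (f x)
  anyV-witness {suc n} {f} t with f zero in eq
  ... | true  = zero , Equivalence.from T-≡ eq
  ... | false = let x , fx = anyV-witness {n} t in suc x , fx

  minimal-witness : {P : Fin n → Set} → Decidable P → (m : Fin n → ℕ) → ∃ P →
    ∃ λ v → P v × (∀ w → P w → m v ≤ m w)
  minimal-witness {n} {P} P? m (w , pw) = descend (m w) w pw ≤-refl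
    where
    descend : ∀ b w → P w → m w ≤ b → ∃ λ v → P v × (∀ u → P u → m v ≤ m u)
    descend b w pw mw≤b with any? (λ u → P? u ×-dec m u <? m w)
    ... | no none = w , pw , λ u pu → ≮⇒≥ λ mu<mw → none (u , pu , mu<mw)
    ... | yes (u , pu , mu<mw) with b
    ...   | zero  = contradiction (≤-trans mu<mw mw≤b) λ ()
    ...   | suc b = descend b u pu (≤-pred (≤-trans mu<mw mw≤b))

module ListLemmas where
  open import Data.Nat using (_+_; _≤_; _<_; s≤s; z≤n)
  open import Data.Nat.Properties using (suc-injective; +-suc; +-assoc; ≤-trans; m≤m+n; m≤n+m)
  open import Data.Nat.ListAction using (sum)
  open import Data.Bool using (Bool; true; false; T; if_then_else_)
  open import Data.Bool.Properties using (T-≡)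
  open import Data.List using ([]; _∷_; length; map)
  open import Data.List.Relation.Unary.Any using (here; there; tail)
  open import Function using (_∘_)
  open import Function.Bundles using (Equivalence)
  open import Relation.Nullary using (yes; no)
  open import Relation.Nullary.Decidable using (⌊_⌋)
  open import Relation.Binary.Definitions using (DecidableEquality)
  open import Relation.Binary.PropositionalEquality using (_≡_; refl; sym; trans; cong)

  module _ {A : Set} where

    ≤-sum-map : (f : A → ℕ) {x : A} {xs : List A} → x ∈ xs → f x ≤ sum (map f xs)
    ≤-sum-map f {xs = y ∷ ys} (here refl) = m≤m+n (f y) (sum (map f ys))
    ≤-sum-map f {xs = y ∷ ys} (there x∈) = ≤-trans (≤-sum-map f x∈) (m≤n+m (sum (map f ys)) (f y))

    sum-map-suc : (f : A → ℕ) (xs : List A) → sum (map (suc ∘ f) xs) ≡ sum (map f xs) + length xs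
    sum-map-suc f []       = refl
    sum-map-suc f (x ∷ xs) = trans (cong (λ s → suc (f x + s)) (sum-map-suc f xs))
                                   (sym (trans (+-suc (f x + sum (map f xs)) (length xs))
                                               (cong suc (+-assoc (f x) (sum (map f xs)) (length xs)))))

    indexOf : (A → Bool) → List A → ℕ
    indexOf p []       = 0
    indexOf p (x ∷ xs) = if p x then 0 else suc (indexOf p xs)

    indexOf-cong : ∀ {p q : A → Bool} xs → (∀ {x} → x ∈ xs → p x ≡ q x) → indexOf p xs ≡ indexOf q xs
    indexOf-cong         []       _   = refl
    indexOf-cong {q = q} (x ∷ xs) p≗q rewrite p≗q (here refl) =
      cong (λ k → if q x then 0 else suc k) (indexOf-cong xs (p≗q ∘ there))

    indexOf-< : ∀ {p x} xs → x ∈ xs → T (p x) → indexOf p xs < length xs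
    indexOf-< (y ∷ ys) (here refl) py rewrite Equivalence.to T-≡ py = s≤s z≤n
    indexOf-< {p} (y ∷ ys) (there x∈ys) px with p y
    ... | true  = s≤s z≤n
    ... | false = s≤s (indexOf-< ys x∈ys px)

    module _ (_≟_ : DecidableEquality A) where

      position : A → List A → ℕ
      position x = indexOf (λ y → ⌊ y ≟ x ⌋)

      position-injective : ∀ {x y} xs → x ∈ xs → y ∈ xs → position x xs ≡ position y xs → x ≡ y
      position-injective {x} {y} (z ∷ zs) x∈ y∈ with z ≟ x | z ≟ y
      ... | yes refl | yes refl = λ _ → refl
      ... | yes _    | no _     = λ ()
      ... | no _     | yes _    = λ ()
      ... | no z≢x   | no z≢y   =
        position-injective zs (tail (z≢x ∘ sym) x∈) (tail (z≢y ∘ sym) y∈) ∘ suc-injective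

module Walks {n : ℕ} (E : Rel₂ n) where
  open import Data.Nat using (_≤_; s≤s; z≤n)
  open import Data.Fin.Properties using (_≟_)
  open import Data.Bool using (T)
  open import Data.List using ([]; _∷_; _∷ʳ_; length)
  open import Data.List.Properties using (∷-injectiveˡ)
  open import Data.List.Membership.Propositional using (_∉_)
  open import Data.List.Membership.DecPropositional (_≟_ {n}) using (_∈?_)
  open import Data.List.Relation.Binary.Subset.Propositional using (_⊆_)
  open import Data.List.Relation.Unary.All as All using (All)
  open import Data.List.Relation.Unary.All.Properties using (¬Any⇒All¬)
  open import Data.List.Relation.Unary.AllPairs using ([]; _∷_)
  open import Data.List.Relation.Unary.Any using (here; there)
  open import Data.List.Relation.Unary.Linked as Linked using (Linked; [-]; _∷_)
  open import Data.Product using (Σ; _×_; _,_)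
  open import Data.Sum using (_⊎_; inj₁; inj₂; [_,_])
  open import Function using (id; _∘_)
  open import Relation.Nullary using (¬_; yes; no; contradiction)
  open import Relation.Binary.PropositionalEquality using (_≡_; _≢_; refl; cong)

  private
    Edge : Fin n → Fin n → Set
    Edge u v = T (E u v)

    variable
      u v w x y : Fin n

  head∉tail : ∀ {z : Fin n} {zs} → Unique (z ∷ zs) → z ∉ zs
  head∉tail (z∉zs ∷ _) z∈zs = All.lookup z∉zs z∈zs refl

  vertices : Walk E u v → List (Fin n)
  vertices (here v)       = v ∷ []
  vertices (step {u} _ p) = u ∷ vertices p

  start∈ : (p : Walk E u v) → u ∈ vertices p
  start∈ (here _)   = here refl
  start∈ (step _ _) = here refl

  end∈ : (p : Walk E u v) → v ∈ vertices p
  end∈ (here _)   = here refl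
  end∈ (step _ p) = there (end∈ p)

  vertices-injectiveˡ : (p : Walk E u v) (q : Walk E x y) → vertices p ≡ vertices q → u ≡ x
  vertices-injectiveˡ (here _)   (here _)   = ∷-injectiveˡ
  vertices-injectiveˡ (here _)   (step _ _) = ∷-injectiveˡ
  vertices-injectiveˡ (step _ _) (here _)   = ∷-injectiveˡ
  vertices-injectiveˡ (step _ _) (step _ _) = ∷-injectiveˡ

  infixr 5 _++ʷ_
  _++ʷ_ : Walk E u v → Walk E v w → Walk E u w
  here _   ++ʷ q = q
  step e p ++ʷ q = step e (p ++ʷ q)

  ∈-++ʷ⁻ : (p : Walk E u v) (q : Walk E v w) → x ∈ vertices (p ++ʷ q) → x ∈ vertices p ⊎ x ∈ vertices q
  ∈-++ʷ⁻ (here _)   q x∈           = inj₂ x∈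
  ∈-++ʷ⁻ (step _ p) q (here x≡u)   = inj₁ (here x≡u)
  ∈-++ʷ⁻ (step _ p) q (there x∈)   = [ inj₁ ∘ there , inj₂ ] (∈-++ʷ⁻ p q x∈)

  module _ (E-sym : Symmetric E) where

    reverse : Walk E u v → Walk E v u
    reverse (here v)           = here v
    reverse (step {u} {v} e p) = reverse p ++ʷ step (E-sym u v e) (here u)

    ∈-reverse⁻ : (p : Walk E u v) → x ∈ vertices (reverse p) → x ∈ vertices p
    ∈-reverse⁻ (here _) x∈ = x∈
    ∈-reverse⁻ (step {u} {v} e p) x∈ with ∈-++ʷ⁻ (reverse p) (step (E-sym u v e) (here u)) x∈
    ... | inj₁ x∈rp               = there (∈-reverse⁻ p x∈rp)
    ... | inj₂ (here refl)        = there (start∈ p)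
    ... | inj₂ (there (here x≡u)) = here x≡u

  suffixFrom : (p : Walk E u v) → x ∈ vertices p →
    Σ (Walk E x v) λ s → (Unique (vertices p) → Unique (vertices s)) × vertices s ⊆ vertices p
  suffixFrom (here v)     (here refl)  = here v , id , id
  suffixFrom p@(step _ _) (here refl)  = p , id , id
  suffixFrom (step _ p)   (there x∈p) with suffixFrom p x∈p
  ... | s , unique , s⊆p = s , (λ { (_ ∷ up) → unique up }) , there ∘ s⊆p

  toPath : (p : Walk E u v) → Σ (Walk E u v) λ q → Unique (vertices q) × vertices q ⊆ vertices p
  toPath (here v) = here v , All.[] ∷ [] , id
  toPath (step {u} e p) with toPath p
  ... | q , uq , q⊆p with u ∈? vertices q
  ...   | no u∉q  = step e q , ¬Any⇒All¬ _ u∉q ∷ uq ,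
                    λ { (here refl) → here refl ; (there y∈q) → there (q⊆p y∈q) }
  ...   | yes u∈q = let s , us , s⊆q = suffixFrom q u∈q in s , us uq , there ∘ q⊆p ∘ s⊆q

  HasCycle-mono : {F : Rel₂ n} → (∀ a b → T (F a b) → Edge a b) → HasCycle F → HasCycle E
  HasCycle-mono F⊆E (v , ws , len , unique , linked) = v , ws , len , unique , Linked.map (F⊆E _ _) linked

  module Acyclic (E-sym : Symmetric E) (acyclic : ¬ HasCycle E) where

    private
      linked : ∀ {a b} → Edge a x → (r : Walk E x y) → Edge y b → Linked Edge (a ∷ vertices r ∷ʳ b)
      linked ax (here _)    yb = ax ∷ yb ∷ [-]
      linked ax (step e r)  yb = ax ∷ linked e r yb

      two≤ : (r : Walk E x y) → x ≢ y → 2 ≤ length (vertices r)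
      two≤ (here _)            x≢x = contradiction refl x≢x
      two≤ (step _ (here _))   _   = s≤s (s≤s z≤n)
      two≤ (step _ (step _ _)) _   = s≤s (s≤s z≤n)

    cycle-through : ∀ {a} (r : Walk E x y) → x ≢ y → Unique (vertices r) → a ∉ vertices r →
      Edge a x → Edge y a → HasCycle E
    cycle-through {a = a} r x≢y ur a∉r ax ya =
      a , vertices r , two≤ r x≢y , ¬Any⇒All¬ _ a∉r ∷ ur , linked ax r ya

    -- If p and q leave their first vertex a towards different neighbours x ≠ y, then the rest of p
    -- followed by q reversed, shortened to a path, avoids a and closes into a cycle through a.
    paths-unique : (p q : Walk E u v) → Unique (vertices p) → Unique (vertices q) → vertices p ≡ vertices q
    paths-unique (here _)   (here _)   _  _  = refl
    paths-unique (here _)   (step _ q) _  uq = contradiction (end∈ q) (head∉tail uq)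
    paths-unique (step _ p) (here _)   up _  = contradiction (end∈ p) (head∉tail up)
    paths-unique {u = a} (step {v = x} e p) (step {v = y} e′ q) up@(_ ∷ up′) uq@(_ ∷ uq′) with x ≟ y
    ... | yes refl = cong (a ∷_) (paths-unique p q up′ uq′)
    ... | no x≢y with toPath (p ++ʷ reverse E-sym q)
    ...   | r , ur , r⊆ = contradiction (cycle-through r x≢y ur a∉r e (E-sym a y e′)) acyclic
      where
      a∉r : a ∉ vertices r
      a∉r a∈r = [ head∉tail up , head∉tail uq ∘ ∈-reverse⁻ E-sym q ]
                  (∈-++ʷ⁻ p (reverse E-sym q) (r⊆ a∈r))

module RootedTreeStructure {n : ℕ} (Tr : RootedTree n) where
  open import Data.Nat using (_≤_; _<_; s≤s)
  open import Data.Nat.Properties using (≤-trans)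
  open import Data.Nat.ListAction using (sum)
  open import Data.Fin.Properties using (_≟_)
  open import Data.Bool using (T; _∧_; not)
  open import Data.Bool.ListAction using (any)
  open import Data.Bool.Properties using (T-∧)
  open import Data.Unit using (tt)
  open import Data.List using ([]; _∷_; length; map; filter; allFin)
  open import Data.List.Properties using (∷-injectiveʳ; ≡-dec)
  open import Data.List.Membership.Propositional using (_∉_; find; lose)
  open import Data.List.Membership.Propositional.Properties using (∈-filter⁺; ∈-filter⁻; ∈-allFin)
  open import Data.List.Membership.DecPropositional (_≟_ {n}) using (_∈?_)
  open import Data.List.Relation.Unary.All as All using (All)
  open import Data.List.Relation.Unary.All.Properties using (¬Any⇒All¬)
  open import Data.List.Relation.Unary.AllPairs using ([]; _∷_)
  open import Data.List.Relation.Unary.Any using (here; there)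
  open import Data.List.Relation.Unary.Any.Properties using (any⁺; any⁻)
  import Data.List.Relation.Unary.Unique.Propositional.Properties as Unique
  open import Data.Product using (Σ; ∃; _×_; _,_; proj₁; proj₂)
  open import Data.Sum using (_⊎_; inj₁; inj₂)
  open import Function using (_∘_)
  open import Function.Bundles using (_⇔_; mk⇔; Equivalence)
  open import Relation.Nullary using (Dec; yes; no; contradiction)
  open import Relation.Nullary.Decidable using (⌊_⌋; toWitness; fromWitness; toWitnessFalse; fromWitnessFalse)
  open import Relation.Binary.PropositionalEquality using (_≡_; _≢_; refl; sym; trans; cong; subst)

  open RootedTree Tr renaming (sym to E-sym)
  open Walks E
  open Acyclic E-sym (proj₂ tree)
  open FiniteCounting
  open ListLemmas using (≤-sum-map)

  private
    Edge : Fin n → Fin n → Set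
    Edge u v = T (E u v)

    variable
      a b c v w x z : Fin n

  -- rootPath w lists the vertices of the unique path from w up to the root, so a ∈ rootPath w says
  -- that a is an ancestor of w (or w itself), and c childOf v says that v is the parent of c.
  opaque
    pathToRoot : ∀ w → Σ (Walk E w root) (Unique ∘ vertices)
    pathToRoot w = let p , up , _ = toPath (proj₁ tree w root tt tt) in p , up

  rootPath : Fin n → List (Fin n)
  rootPath w = vertices (proj₁ (pathToRoot w))

  rootPath-unique : ∀ w → Unique (rootPath w)
  rootPath-unique w = proj₂ (pathToRoot w)

  rootPath-of : (p : Walk E w root) → Unique (vertices p) → rootPath w ≡ vertices p
  rootPath-of p up = paths-unique _ p (rootPath-unique _) up

  self∈rootPath : ∀ w → w ∈ rootPath w
  self∈rootPath w = start∈ (proj₁ (pathToRoot w))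

  root∈rootPath : ∀ w → root ∈ rootPath w
  root∈rootPath w = end∈ (proj₁ (pathToRoot w))

  rootPath-injective : rootPath a ≡ rootPath b → a ≡ b
  rootPath-injective {a} {b} eq = vertices-injectiveˡ (proj₁ (pathToRoot a)) (proj₁ (pathToRoot b)) eq

  ∈-rootPath-root : a ∈ rootPath root → a ≡ root
  ∈-rootPath-root a∈ with subst (_ ∈_) (rootPath-of (here root) (All.[] ∷ [])) a∈
  ... | here a≡root = a≡root

  infix 4 _childOf_
  _childOf_ : Fin n → Fin n → Set
  c childOf v = rootPath c ≡ c ∷ rootPath v

  step-childOf : (e : Edge w x) (p : Walk E x root) → Unique (w ∷ vertices p) → w childOf x
  step-childOf e p u@(_ ∷ up) = trans (rootPath-of (step e p) u) (cong (_ ∷_) (sym (rootPath-of p up)))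

  parent : w ≢ root → ∃ (w childOf_)
  parent w≢root = along _ (rootPath-unique _) w≢root
    where
    along : (p : Walk E w root) → Unique (vertices p) → w ≢ root → ∃ (w childOf_)
    along (here _)   _  w≢root = contradiction refl w≢root
    along (step e p) up _      = _ , step-childOf e p up

  childOf⇒edge : c childOf v → Edge c v
  childOf⇒edge = along (proj₁ (pathToRoot _)) refl
    where
    along : (p : Walk E c root) → rootPath c ≡ vertices p → c childOf v → Edge c v
    along {v = v} (here _) eq c◃v =
      contradiction (subst (v ∈_) (∷-injectiveʳ (trans (sym c◃v) eq)) (self∈rootPath v)) λ ()
    along {v = v} (step e p) eq c◃v =
      subst (Edge _) (vertices-injectiveˡ p (proj₁ (pathToRoot v)) (∷-injectiveʳ (trans (sym eq) c◃v))) e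

  childOf-∉ : c childOf v → c ∉ rootPath v
  childOf-∉ {c} c◃v = head∉tail (subst Unique c◃v (rootPath-unique c))

  ∈-childOf⁺ : w childOf z → a ∈ rootPath z → a ∈ rootPath w
  ∈-childOf⁺ w◃z a∈ = subst (_ ∈_) (sym w◃z) (there a∈)

  ∈-childOf⁻ : w childOf z → a ∈ rootPath w → a ≡ w ⊎ a ∈ rootPath z
  ∈-childOf⁻ w◃z a∈ with subst (_ ∈_) w◃z a∈
  ... | here a≡w  = inj₁ a≡w
  ... | there a∈z = inj₂ a∈z

  depth-induction : (P : Fin n → Set) → P root → (∀ {w z} → w childOf z → P z → P w) → ∀ w → P w
  depth-induction P base extend w = go w (rootPath w) refl
    where
    go : ∀ w ps → rootPath w ≡ ps → P w
    go w []       eq = contradiction (subst (w ∈_) eq (self∈rootPath w)) λ ()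
    go w (_ ∷ ps) eq with w ≟ root
    ... | yes refl   = base
    ... | no w≢root  = let z , w◃z = parent w≢root in extend w◃z (go z ps (∷-injectiveʳ (trans (sym w◃z) eq)))

  rootPath-trans : a ∈ rootPath b → b ∈ rootPath c → a ∈ rootPath c
  rootPath-trans {a} {b} a∈b = depth-induction P base extend _
    where
    P : Fin n → Set
    P w = b ∈ rootPath w → a ∈ rootPath w
    base : P root
    base b∈ = subst (λ r → a ∈ rootPath r) (∈-rootPath-root b∈) a∈b
    extend : w childOf z → P z → P w
    extend w◃z ih b∈w with ∈-childOf⁻ w◃z b∈w
    ... | inj₁ refl = a∈b
    ... | inj₂ b∈z  = ∈-childOf⁺ w◃z (ih b∈z)

  rootPath-antisym : a ∈ rootPath b → b ∈ rootPath a → a ≡ b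
  rootPath-antisym {a} {b} a∈b b∈a with b ≟ root
  ... | yes refl = ∈-rootPath-root a∈b
  ... | no b≢root with parent b≢root
  ...   | z , b◃z with ∈-childOf⁻ b◃z a∈b
  ...     | inj₁ a≡b = a≡b
  ...     | inj₂ a∈z = contradiction (rootPath-trans b∈a a∈z) (childOf-∉ b◃z)

  rootPath-total : a ∈ rootPath w → b ∈ rootPath w → a ∈ rootPath b ⊎ b ∈ rootPath a
  rootPath-total {a} {w = w₀} {b} = depth-induction P base extend w₀
    where
    P : Fin n → Set
    P w = a ∈ rootPath w → b ∈ rootPath w → a ∈ rootPath b ⊎ b ∈ rootPath a
    base : P root
    base a∈ b∈ = inj₁ (subst (_∈ rootPath b) (trans (∈-rootPath-root b∈) (sym (∈-rootPath-root a∈)))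
                             (self∈rootPath b))
    extend : w childOf z → P z → P w
    extend w◃z ih a∈w b∈w with ∈-childOf⁻ w◃z a∈w | ∈-childOf⁻ w◃z b∈w
    ... | inj₁ refl | _         = inj₂ b∈w
    ... | _         | inj₁ refl = inj₁ a∈w
    ... | inj₂ a∈z  | inj₂ b∈z  = ih a∈z b∈z

  children-disjoint : a childOf v → b childOf v → a ∈ rootPath w → b ∈ rootPath w → a ≡ b
  children-disjoint a◃v b◃v a∈w b∈w with rootPath-total a∈w b∈w
  ... | inj₁ a∈b with ∈-childOf⁻ b◃v a∈b
  ...   | inj₁ a≡b = a≡b
  ...   | inj₂ a∈v = contradiction a∈v (childOf-∉ a◃v)
  children-disjoint a◃v b◃v a∈w b∈w | inj₂ b∈a with ∈-childOf⁻ a◃v b∈a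
  ...   | inj₁ b≡a = sym b≡a
  ...   | inj₂ b∈v = contradiction b∈v (childOf-∉ b◃v)

  edge⇒childOf : Edge a b → a childOf b ⊎ b childOf a
  edge⇒childOf {a} {b} e with a ∈? rootPath b | b ∈? rootPath a
  ... | no a∉b  | _       = inj₁ (step-childOf e _ (¬Any⇒All¬ _ a∉b ∷ rootPath-unique b))
  ... | yes _   | no b∉a  = inj₂ (step-childOf (E-sym a b e) _ (¬Any⇒All¬ _ b∉a ∷ rootPath-unique a))
  ... | yes a∈b | yes b∈a = contradiction (subst (Edge a) (sym (rootPath-antisym a∈b b∈a)) e) (irrefl a)

  child-below : v ∈ rootPath w → w ≢ v → ∃ λ c → c childOf v × c ∈ rootPath w
  child-below {v} {w₀} = depth-induction P base extend w₀
    where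
    P : Fin n → Set
    P w = v ∈ rootPath w → w ≢ v → ∃ λ c → c childOf v × c ∈ rootPath w
    base : P root
    base v∈ root≢v = contradiction (sym (∈-rootPath-root v∈)) root≢v
    extend : w childOf z → P z → P w
    extend {w} {z} w◃z ih v∈w w≢v with ∈-childOf⁻ w◃z v∈w
    ... | inj₁ v≡w = contradiction (sym v≡w) w≢v
    ... | inj₂ v∈z with z ≟ v
    ...   | yes refl = w , w◃z , self∈rootPath w
    ...   | no z≢v   = let c , c◃v , c∈z = ih v∈z z≢v in c , c◃v , ∈-childOf⁺ w◃z c∈z

  subtree : Fin n → VSet n
  subtree c w = ⌊ c ∈? rootPath w ⌋

  properSubtree : Fin n → VSet n
  properSubtree c w = subtree c w ∧ not ⌊ w ≟ c ⌋

  T-subtree : T (subtree c w) ⇔ c ∈ rootPath w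
  T-subtree = mk⇔ toWitness fromWitness

  T-properSubtree : T (properSubtree c w) ⇔ (c ∈ rootPath w × w ≢ c)
  T-properSubtree {c} {w} = mk⇔
    (λ t → let s , ne = Equivalence.to (T-∧ {subtree c w}) t in toWitness s , toWitnessFalse ne)
    (λ (c∈w , w≢c) → Equivalence.from (T-∧ {subtree c w}) (fromWitness c∈w , fromWitnessFalse w≢c))

  size : Fin n → ℕ
  size c = count (subtree c)

  size≡suc-properSubtree : ∀ c → size c ≡ suc (count (properSubtree c))
  size≡suc-properSubtree c = count-remove c (fromWitness (self∈rootPath c))

  _childOf?_ : ∀ c v → Dec (c childOf v)
  c childOf? v = ≡-dec _≟_ (rootPath c) (c ∷ rootPath v)

  children : Fin n → List (Fin n)
  children v = filter (_childOf? v) (allFin n)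

  children-childOf : c ∈ children v → c childOf v
  children-childOf {v = v} = proj₂ ∘ ∈-filter⁻ (_childOf? v) {xs = allFin n}

  childOf-children : c childOf v → c ∈ children v
  childOf-children {c} = ∈-filter⁺ (_childOf? _) (∈-allFin c)

  children-unique : ∀ v → Unique (children v)
  children-unique v = Unique.filter⁺ (_childOf? v) (Unique.allFin⁺ n)

  length-children : ∀ {Δ} → MaxDegree≤ E Δ → ∀ v → length (children v) ≤ Δ
  length-children deg v = ≤-trans (length≤count (children-unique v) (All.tabulate neighbour)) (deg v)
    where
    neighbour : c ∈ children v → Edge v c
    neighbour c∈ = E-sym _ _ (childOf⇒edge (children-childOf c∈))

  properSubtree-children : ∀ v → count (properSubtree v) ≡ sum (map size (children v))
  properSubtree-children v =
    trans (count-cong λ w → T-⇔⇒≡ (mk⇔ (down {w}) (up {w})))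
          (count-any subtree (children-unique v) λ c∈ c′∈ c∈w c′∈w →
             children-disjoint (children-childOf c∈) (children-childOf c′∈)
                               (Equivalence.to T-subtree c∈w) (Equivalence.to T-subtree c′∈w))
    where
    down : T (properSubtree v w) → T (any (λ c → subtree c w) (children v))
    down t = let v∈w , w≢v = Equivalence.to T-properSubtree t
                 c , c◃v , c∈w = child-below v∈w w≢v
             in any⁺ _ (lose (childOf-children c◃v) (Equivalence.from T-subtree c∈w))
    up : T (any (λ c → subtree c w) (children v)) → T (properSubtree v w)
    up t with find (any⁻ _ (children v) t)
    ... | c , c∈ , c∈w′ = Equivalence.from T-properSubtree
      (rootPath-trans (∈-childOf⁺ c◃v (self∈rootPath v)) c∈w , λ { refl → childOf-∉ c◃v c∈w })
      where
      c◃v = children-childOf c∈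
      c∈w = Equivalence.to T-subtree c∈w′

  size-children : ∀ v → size v ≡ suc (sum (map size (children v)))
  size-children v = trans (size≡suc-properSubtree v) (cong suc (properSubtree-children v))

  childOf-size< : c childOf v → size c < size v
  childOf-size< {c} {v} c◃v = subst (size c <_) (sym (size-children v)) (s≤s (≤-sum-map size (childOf-children c◃v)))

module NatToRational where
  import Data.Nat as ℕ
  import Data.Nat.Properties as ℕ
  open import Data.Nat.Coprimality using (1-coprimeTo) renaming (sym to coprime-sym)
  import Data.Integer as ℤ
  import Data.Integer.Properties as ℤ
  open import Data.Rational using (mkℚ; _/_; 0ℚ; _+_; _≤_; _<_; *≤*; *<*)
  open import Data.Rational.Properties using (normalize-coprime)
  open import Relation.Binary.PropositionalEquality using (_≡_; sym; cong; cong₂)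

  private
    ℕ→ℚ-mkℚ : ∀ m → ℕ→ℚ m ≡ mkℚ (ℤ.+ m) 0 (coprime-sym (1-coprimeTo m))
    ℕ→ℚ-mkℚ m = normalize-coprime (coprime-sym (1-coprimeTo m))

  ℕ→ℚ-+ : ∀ a b → ℕ→ℚ (a ℕ.+ b) ≡ ℕ→ℚ a + ℕ→ℚ b
  ℕ→ℚ-+ a b rewrite ℕ→ℚ-mkℚ a | ℕ→ℚ-mkℚ b =
    cong (_/ 1) (sym (cong₂ ℤ._+_ (ℤ.*-identityʳ (ℤ.+ a)) (ℤ.*-identityʳ (ℤ.+ b))))

  ℕ→ℚ-mono-≤ : ∀ {a b} → a ℕ.≤ b → ℕ→ℚ a ≤ ℕ→ℚ b
  ℕ→ℚ-mono-≤ {a} {b} a≤b rewrite ℕ→ℚ-mkℚ a | ℕ→ℚ-mkℚ b =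
    *≤* (ℤ.*-monoʳ-≤-nonNeg (ℤ.+ 1) (ℤ.+≤+ a≤b))

  ℕ→ℚ-mono-< : ∀ {a b} → a ℕ.< b → ℕ→ℚ a < ℕ→ℚ b
  ℕ→ℚ-mono-< {a} {b} a<b rewrite ℕ→ℚ-mkℚ a | ℕ→ℚ-mkℚ b =
    *<* (ℤ.*-monoʳ-<-pos (ℤ.+ 1) (ℤ.+<+ a<b))

  ℕ→ℚ-nonNeg : ∀ a → 0ℚ ≤ ℕ→ℚ a
  ℕ→ℚ-nonNeg a = ℕ→ℚ-mono-≤ {0} {a} ℕ.z≤n

module RationalArithmetic where
  open import Data.Rational using (ℚ; 0ℚ; 1ℚ; _+_; _-_; -_; _*_; _≤_; _<_; positive; nonNegative)
  open import Data.Rational.Properties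
  open import Data.Rational.Solver using (module +-*-Solver)
  open import Relation.Binary.PropositionalEquality using (_≡_; refl; sym; trans; cong)
  open +-*-Solver

  ≤+⇒-≤ : ∀ {a b c} → a ≤ b + c → a - c ≤ b
  ≤+⇒-≤ {a} {b} {c} a≤b+c =
    ≤-trans (+-monoˡ-≤ (- c) a≤b+c) (≤-reflexive (solve 2 (λ b c → (b :+ c) :- c := b) refl b c))

  -- ℕ→ℚ 2 is closed and computes to 1ℚ + 1ℚ, so the solver closes the first step by refl.
  complement-lower : ∀ {p q r N} → q + r ≡ N → r ≤ p * N + p * N → (1ℚ - ℕ→ℚ 2 * p) * N ≤ q
  complement-lower {p} {q} {r} {N} q+r≡N r≤2pN = begin
    (1ℚ - ℕ→ℚ 2 * p) * N
      ≡⟨ solve 2 (λ p N → (con 1ℚ :- (con 1ℚ :+ con 1ℚ) :* p) :* N := N :- (p :* N :+ p :* N)) refl p N ⟩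
    N - (p * N + p * N)  ≤⟨ +-monoʳ-≤ N (neg-antimono-≤ r≤2pN) ⟩
    N - r                ≡⟨ cong (_- r) (sym q+r≡N) ⟩
    (q + r) - r          ≡⟨ solve 2 (λ q r → (q :+ r) :- r := q) refl q r ⟩
    q                    ∎
    where open ≤-Reasoning

  complement-upper : ∀ {p q r d N} → q + r ≡ N → p * N - d ≤ r → q ≤ (1ℚ - p) * N + d
  complement-upper {p} {q} {r} {d} {N} q+r≡N pN-d≤r = begin
    q                ≡⟨ solve 2 (λ q r → q := (q :+ r) :- r) refl q r ⟩
    (q + r) - r      ≡⟨ cong (_- r) q+r≡N ⟩
    N - r            ≤⟨ +-monoʳ-≤ N (neg-antimono-≤ pN-d≤r) ⟩
    N - (p * N - d)  ≡⟨ solve 3 (λ p N d → N :- (p :* N :- d) := (con 1ℚ :- p) :* N :+ d) refl p N d ⟩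
    (1ℚ - p) * N + d ∎
    where open ≤-Reasoning

  *<-self : ∀ {p q} → p < 1ℚ → 0ℚ < q → p * q < q
  *<-self {p} {q} p<1 0<q =
    <-≤-trans (*-monoˡ-<-pos q {{positive 0<q}} p<1) (≤-reflexive (*-identityˡ q))

  0≤* : ∀ {p q} → 0ℚ ≤ p → 0ℚ ≤ q → 0ℚ ≤ p * q
  0≤* {p} {q} 0≤p 0≤q =
    ≤-trans (≤-reflexive (sym (*-zeroˡ q))) (*-monoʳ-≤-nonNeg q {{nonNegative 0≤q}} 0≤p)

module PrefixSums {L θ : ℚ} (0≤L : 0ℚ ℚ.≤ L) (θ≤L : θ ℚ.≤ L) where
  import Data.Nat as ℕ
  import Data.Nat.Properties as ℕ
  open import Data.Nat.ListAction using (sum)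
  open import Data.Rational using (0ℚ; _+_; _≤_; _<_)
  open import Data.Rational.Properties using (_≤?_; ≤-trans; ≤-reflexive; <⇒≤; <-≤-trans; <-irrefl; ≰⇒>; +-mono-≤)
  open import Data.List using ([]; _∷_; take)
  open import Data.List.Relation.Unary.All using (All; []; _∷_)
  open import Data.Product using (∃; _×_; _,_)
  open import Relation.Nullary using (yes; no; contradiction)
  open import Relation.Binary.PropositionalEquality using (refl; sym; subst)
  open NatToRational using (ℕ→ℚ-+)

  Between : ℕ → Set
  Between m = θ ≤ ℕ→ℚ m × ℕ→ℚ m ≤ L + L

  -- The first prefix sum reaching θ exceeds its predecessor, which is below θ ≤ L, by one term ≤ L.
  private
    crossing : ∀ as acc → All (λ a → ℕ→ℚ a ≤ L) as → ℕ→ℚ acc < θ → θ ≤ ℕ→ℚ (acc ℕ.+ sum as) →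
      ∃ λ j → Between (acc ℕ.+ sum (take j as))
    crossing [] acc [] acc<θ θ≤acc =
      contradiction (<-≤-trans acc<θ (subst (λ m → θ ≤ ℕ→ℚ m) (ℕ.+-identityʳ acc) θ≤acc)) (<-irrefl refl)
    crossing (a ∷ as) acc (a≤L ∷ as≤L) acc<θ θ≤total with θ ≤? ℕ→ℚ (acc ℕ.+ a)
    ... | yes θ≤acc+a = 1 , subst (λ m → Between (acc ℕ.+ m)) (sym (ℕ.+-identityʳ a)) (θ≤acc+a , acc+a≤L+L)
      where
      acc+a≤L+L : ℕ→ℚ (acc ℕ.+ a) ≤ L + L
      acc+a≤L+L = ≤-trans (≤-reflexive (ℕ→ℚ-+ acc a)) (+-mono-≤ (≤-trans (<⇒≤ acc<θ) θ≤L) a≤L)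
    ... | no θ≰acc+a = extend (crossing as (acc ℕ.+ a) as≤L (≰⇒> θ≰acc+a) θ≤total′)
      where
      θ≤total′ : θ ≤ ℕ→ℚ (acc ℕ.+ a ℕ.+ sum as)
      θ≤total′ = subst (λ m → θ ≤ ℕ→ℚ m) (sym (ℕ.+-assoc acc a (sum as))) θ≤total
      extend : (∃ λ j → Between (acc ℕ.+ a ℕ.+ sum (take j as))) →
               ∃ λ j → Between (acc ℕ.+ sum (take j (a ∷ as)))
      extend (j , between) = suc j , subst Between (ℕ.+-assoc acc a (sum (take j as))) between

  prefix-sum-between : ∀ as → All (λ a → ℕ→ℚ a ≤ L) as → θ ≤ ℕ→ℚ (sum as) →
    ∃ λ j → Between (sum (take j as))
  prefix-sum-between as as≤L θ≤sum with θ ≤? 0ℚ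
  ... | yes θ≤0 = 0 , θ≤0 , +-mono-≤ 0≤L 0≤L
  ... | no  θ≰0 = crossing as 0 as≤L (≰⇒> θ≰0) θ≤sum

module Pruning {n : ℕ} (Tr : RootedTree n) {v : Fin n} (cs : List (Fin n))
               (cs-childOf : ∀ {c} → c ∈ cs → RootedTreeStructure._childOf_ Tr c v) (cs-unique : Unique cs)
  where
  open import Data.Nat using (_+_; _≤_; _<_)
  open import Data.Nat.Properties using (≤-trans; ≤-refl)
  open import Data.Nat.DivMod using (_mod_; m<n⇒m%n≡m)
  open import Data.Nat.ListAction using (sum)
  open import Data.Fin using (toℕ)
  open import Data.Fin.Properties using (_≟_; toℕ-fromℕ<)
  open import Data.Bool using (true; false; T; _∧_; _∨_; not)
  open import Data.Bool.ListAction using (any)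
  open import Data.Bool.Properties using (T-∧; T-∨)
  open import Data.List using (length; map)
  open import Data.List.Membership.Propositional using (find; lose)
  open import Data.List.Relation.Unary.Any.Properties using (any⁺; any⁻)
  open import Data.Product using (∃; _×_; _,_; proj₁; proj₂)
  open import Data.Sum using (_⊎_; inj₁; inj₂; [_,_]′; swap)
  open import Function using (_∘_)
  open import Function.Bundles using (_⇔_; mk⇔; Equivalence)
  open import Relation.Nullary using (yes; no; contradiction)
  open import Relation.Nullary.Decidable using (⌊_⌋; toWitness; fromWitness)
  open import Relation.Binary.PropositionalEquality using (_≡_; _≢_; refl; sym; trans; cong; subst)
  open RootedTree Tr renaming (sym to E-sym)
  open RootedTreeStructure Tr
  open Walks E using (HasCycle-mono)
  open FiniteCounting
  open ListLemmas
  open NatToRational using (ℕ→ℚ-mono-≤)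

  private
    Edge : Fin n → Fin n → Set
    Edge u v = T (E u v)

    variable
      a b c w z : Fin n

  -- The chosen children themselves stay in Q, so the subtree at a chosen child is a connected part
  -- of T ∖ Q.
  removed : VSet n
  removed w = any (λ c → properSubtree c w) cs

  kept : VSet n
  kept w = not (removed w)

  T-removed : T (removed w) ⇔ (∃ λ c → c ∈ cs × c ∈ rootPath w × w ≢ c)
  T-removed = mk⇔
    (λ t → let c , c∈ , t′ = find (any⁻ _ cs t) ; c∈w , w≢c = Equivalence.to T-properSubtree t′
           in c , c∈ , c∈w , w≢c)
    (λ (c , c∈ , c∈w , w≢c) → any⁺ _ (lose c∈ (Equivalence.from T-properSubtree (c∈w , w≢c))))

  count-removed : count removed ≡ sum (map (count ∘ properSubtree) cs)
  count-removed = count-any properSubtree cs-unique λ c∈ c′∈ t t′ →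
    children-disjoint (cs-childOf c∈) (cs-childOf c′∈)
      (proj₁ (Equivalence.to T-properSubtree t)) (proj₁ (Equivalence.to T-properSubtree t′))

  count-kept+removed : count kept + count removed ≡ n
  count-kept+removed = count-not removed

  kept-parent : w childOf z → T (kept w) → T (kept z)
  kept-parent {w} {z} w◃z kept-w = Equivalence.from T-not λ removed-z →
    let c , c∈ , c∈z , z≢c = Equivalence.to T-removed removed-z
    in Equivalence.to T-not kept-w (Equivalence.from T-removed
         (c , c∈ , ∈-childOf⁺ w◃z c∈z , λ { refl → childOf-∉ w◃z c∈z }))

  root-kept : T (kept root)
  root-kept = Equivalence.from T-not λ removed-root →
    let c , _ , c∈root , root≢c = Equivalence.to T-removed removed-root in root≢c (sym (∈-rootPath-root c∈root))

  EQ : Rel₂ n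
  EQ a b = E a b ∧ (kept a ∧ kept b)

  private
    EQ⊆E : ∀ a b → T (EQ a b) → Edge a b
    EQ⊆E a b = proj₁ ∘ Equivalence.to T-∧

    EQ-ends : ∀ a b → T (EQ a b) → T (kept a) × T (kept b)
    EQ-ends a b = Equivalence.to T-∧ ∘ proj₂ ∘ Equivalence.to (T-∧ {E a b})

    EQ-sym : Symmetric EQ
    EQ-sym a b t = let kept-a , kept-b = EQ-ends a b t in
      Equivalence.from T-∧ (E-sym a b (EQ⊆E a b t) , Equivalence.from T-∧ (kept-b , kept-a))

    walk-to-root : T (kept w) → Walk EQ w root
    walk-to-root {w₀} = depth-induction P (λ _ → here root) extend w₀
      where
      P : Fin n → Set
      P w = T (kept w) → Walk EQ w root
      extend : w childOf z → P z → P w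
      extend w◃z ih kept-w = step w-z (ih kept-z)
        where
        kept-z = kept-parent w◃z kept-w
        w-z    = Equivalence.from T-∧ (childOf⇒edge w◃z , Equivalence.from T-∧ (kept-w , kept-z))

  Q : Subtree Tr
  Q = record
    { VQ      = kept
    ; EQ      = EQ
    ; EQ⊆E    = EQ⊆E
    ; EQ-sym  = EQ-sym
    ; EQ-ends = EQ-ends
    ; isTree  = (λ u w kept-u kept-w → walk-to-root kept-u WQ.++ʷ WQ.reverse EQ-sym (walk-to-root kept-w))
              , proj₂ tree ∘ HasCycle-mono EQ⊆E
    ; hasRoot = root-kept
    }
    where module WQ = Walks EQ

  diff : Rel₂ n
  diff = diffE E EQ

  private
    ∧-not-∧ : ∀ e x y → e ∧ not (e ∧ (not x ∧ not y)) ≡ e ∧ (x ∨ y)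
    ∧-not-∧ false _     _     = refl
    ∧-not-∧ true  true  _     = refl
    ∧-not-∧ true  false true  = refl
    ∧-not-∧ true  false false = refl

  T-diff : T (diff a b) ⇔ (Edge a b × (T (removed a) ⊎ T (removed b)))
  T-diff {a} {b} = mk⇔
    (λ t → let e , r = Equivalence.to (T-∧ {E a b}) (subst T (∧-not-∧ (E a b) (removed a) (removed b)) t)
           in e , Equivalence.to T-∨ r)
    (λ (e , r) → subst T (sym (∧-not-∧ (E a b) (removed a) (removed b)))
                   (Equivalence.from T-∧ (e , Equivalence.from (T-∨ {removed a}) r)))

  diff-sym : Symmetric diff
  diff-sym a b t = let e , r = Equivalence.to T-diff t in Equivalence.from T-diff (E-sym a b e , swap r)

  above-removed-edge : Edge a b → T (removed b) → ∃ λ c → c ∈ cs × c ∈ rootPath a × c ∈ rootPath b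
  above-removed-edge e removed-b with Equivalence.to T-removed removed-b
  ... | c , c∈ , c∈b , b≢c with edge⇒childOf e
  ...   | inj₁ a◃b = c , c∈ , ∈-childOf⁺ a◃b c∈b , c∈b
  ...   | inj₂ b◃a with ∈-childOf⁻ b◃a c∈b
  ...     | inj₁ c≡b = contradiction (sym c≡b) b≢c
  ...     | inj₂ c∈a = c , c∈ , c∈a , c∈b

  above-diff-edge : T (diff a b) → ∃ λ c → c ∈ cs × c ∈ rootPath a × c ∈ rootPath b
  above-diff-edge {a} {b} t with Equivalence.to T-diff t
  ... | e , inj₂ removed-b = above-removed-edge e removed-b
  ... | e , inj₁ removed-a =
    let c , c∈ , c∈b , c∈a = above-removed-edge (E-sym a b e) removed-a in c , c∈ , c∈a , c∈b

  above-nonisolated : T (diffV diff w) → ∃ λ c → c ∈ cs × c ∈ rootPath w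
  above-nonisolated {w} t with anyV-witness {n} {diff w} t
  ... | _ , t′ with above-diff-edge t′
  ...   | c , c∈ , c∈w , _ = c , c∈ , c∈w

  walk-to-chosen : c ∈ cs → c ∈ rootPath w → Walk diff w c
  walk-to-chosen {c} {w₀} c∈ = depth-induction P base extend w₀
    where
    P : Fin n → Set
    P w = c ∈ rootPath w → Walk diff w c
    base : P root
    base c∈root = subst (Walk diff root) (sym (∈-rootPath-root c∈root)) (here root)
    extend : w childOf z → P z → P w
    extend {w} w◃z ih c∈w with w ≟ c
    ... | yes refl = here w
    ... | no w≢c with ∈-childOf⁻ w◃z c∈w
    ...   | inj₁ c≡w = contradiction (sym c≡w) w≢c
    ...   | inj₂ c∈z = step (Equivalence.from T-diff (childOf⇒edge w◃z , inj₁ removed-w)) (ih c∈z)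
      where removed-w = Equivalence.from T-removed (c , c∈ , c∈w , w≢c)

  label : Fin n → ℕ
  label w = indexOf (λ c → subtree c w) cs

  label-position : c ∈ cs → c ∈ rootPath w → label w ≡ position _≟_ c cs
  label-position {c} {w} c∈ c∈w = indexOf-cong cs λ {c′} c′∈ → T-⇔⇒≡ (mk⇔
    (λ t → fromWitness (children-disjoint (cs-childOf c′∈) (cs-childOf c∈) (Equivalence.to T-subtree t) c∈w))
    (λ t → Equivalence.from T-subtree (subst (_∈ rootPath w) (sym (toWitness t)) c∈w)))

  label-< : c ∈ cs → c ∈ rootPath w → label w < length cs
  label-< c∈ c∈w = indexOf-< cs c∈ (Equivalence.from T-subtree c∈w)

  module _ (Δ′ : ℕ) (cs-length : length cs ≤ suc Δ′) where

    -- On T ∖ Q the label is the position in cs of the chosen child above, which is below length cs,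
    -- so reducing it modulo suc Δ′ changes nothing there.
    component : Fin n → Fin (suc Δ′)
    component w = label w mod suc Δ′

    toℕ-component : c ∈ cs → c ∈ rootPath w → toℕ (component w) ≡ position _≟_ c cs
    toℕ-component c∈ c∈w =
      trans (toℕ-fromℕ< _) (trans (m<n⇒m%n≡m (≤-trans (label-< c∈ c∈w) cs-length)) (label-position c∈ c∈w))

    component-determines : ∀ {c c′ u} → c ∈ cs → c ∈ rootPath u → c′ ∈ cs → c′ ∈ rootPath w →
      component u ≡ component w → c ≡ c′
    component-determines c∈ c∈u c′∈ c′∈w eq = position-injective _≟_ cs c∈ c′∈
      (trans (sym (toℕ-component c∈ c∈u)) (trans (cong toℕ eq) (toℕ-component c′∈ c′∈w)))

    walk⇒component : ∀ {u} → Walk diff u w → component u ≡ component w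
    walk⇒component (here _)   = refl
    walk⇒component (step e p) with above-diff-edge e
    ... | c , c∈ , c∈a , c∈b =
      trans (cong (_mod suc Δ′) (trans (label-position c∈ c∈a) (sym (label-position c∈ c∈b)))) (walk⇒component p)

    component⇒walk : ∀ {u} → T (diffV diff u) → T (diffV diff w) → component u ≡ component w → Walk diff u w
    component⇒walk tu tw eq with above-nonisolated tu | above-nonisolated tw
    ... | c , c∈ , c∈u | c′ , c′∈ , c′∈w with component-determines c∈ c∈u c′∈ c′∈w eq
    ...   | refl = walk-to-chosen c∈ c∈u WD.++ʷ WD.reverse diff-sym (walk-to-chosen c′∈ c′∈w)
      where module WD = Walks diff

    class : Fin (suc Δ′) → VSet n
    class i x = diffV diff x ∧ ⌊ component x ≟ i ⌋

    T-class : ∀ {i x} → T (class i x) → T (diffV diff x) × component x ≡ i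
    T-class {i} {x} t = let nx , ix = Equivalence.to (T-∧ {diffV diff x}) t in nx , toWitness ix

    class⊆subtree : ∀ {c i x y} → c ∈ cs → c ∈ rootPath x → T (class i x) → T (class i y) → T (subtree c y)
    class⊆subtree {y = y} c∈ c∈x tx ty with above-nonisolated (proj₁ (T-class ty))
    ... | c′ , c′∈ , c′∈y = Equivalence.from T-subtree (subst (_∈ rootPath y) c′≡c c′∈y)
      where
      c′≡c = component-determines c′∈ c′∈y c∈ c∈x (trans (proj₂ (T-class ty)) (sym (proj₂ (T-class tx))))

    few-small-components : ∀ {B} → 0ℚ ℚ.≤ B → (∀ {c} → c ∈ cs → ℕ→ℚ (size c) ℚ.≤ B) →
      FewSmallComponents (diffV diff) diff (suc Δ′) B
    few-small-components {B} 0≤B small =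
      suc Δ′ , ≤-refl , component , (λ u w tu tw → mk⇔ (component⇒walk tu tw) walk⇒component) , class-size
      where
      class-size : ∀ i → ℕ→ℚ (count (class i)) ℚ.≤ B
      class-size i = [ empty , inhabited ]′ (count≡0-or-witness (class i))
        where
        empty : count (class i) ≡ 0 → ℕ→ℚ (count (class i)) ℚ.≤ B
        empty eq = subst (λ m → ℕ→ℚ m ℚ.≤ B) (sym eq) 0≤B
        inhabited : ∃ (T ∘ class i) → ℕ→ℚ (count (class i)) ℚ.≤ B
        inhabited (x , tx) = below (above-nonisolated (proj₁ (T-class tx)))
          where
          below : ∃ (λ c → c ∈ cs × c ∈ rootPath x) → ℕ→ℚ (count (class i)) ℚ.≤ B
          below (c , c∈ , c∈x) =
            ℚ.≤-trans (ℕ→ℚ-mono-≤ {count (class i)} {size c} (count-mono {n} {class i} {subtree c} class⊆c))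
                      (small c∈)
            where
            class⊆c : ∀ y → T (class i y) → T (subtree c y)
            class⊆c _ = class⊆subtree c∈ c∈x tx

module BalancedSplit {n : ℕ} (Tr : RootedTree n) {Δ′ : ℕ} (deg : MaxDegree≤ (RootedTree.E Tr) (suc Δ′))
                     {L : ℚ} (0≤L : 0ℚ ℚ.≤ L) where
  open import Data.Nat using (_+_; _*_; _≤_; s≤s)
  import Data.Nat.Properties
  open Data.Nat.Properties using (≤-trans; ≤-reflexive; +-suc; +-monoʳ-≤; m≤m+n; <-irrefl; <-≤-trans)
  open import Data.Nat.Solver using (module +-*-Solver)
  open import Data.Nat.ListAction using (sum)
  open import Data.List using (length; map; take)
  open import Data.List.Properties using (map-cong; take-map; length-take)
  open import Data.List.Relation.Unary.All as All using (All)
  open import Data.List.Relation.Unary.All.Properties using (map⁺)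
  open import Data.List.Relation.Binary.Sublist.Propositional using (lookup)
  open import Data.List.Relation.Binary.Sublist.Propositional.Properties using (take-⊆)
  import Data.List.Relation.Unary.Unique.Propositional.Properties as Unique
  open import Data.Product using (∃; _×_; _,_; proj₁; proj₂)
  open import Function using (_∘_)
  open import Function.Bundles using (Equivalence)
  open import Relation.Binary.PropositionalEquality using (_≡_; refl; sym; trans; cong; subst)

  open RootedTree Tr using (E; root)
  open RootedTreeStructure Tr
  open FiniteCounting
  open ListLemmas
  open NatToRational
  open RationalArithmetic

  Δ : ℕ
  Δ = suc Δ′

  θ : ℚ
  θ = L ℚ.- ℕ→ℚ (2 * Δ)

  record Split : Set where
    field
      Q               : Subtree Tr
      removed         : ℕ
      kept+removed≡n  : count (Subtree.VQ Q) + removed ≡ n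
      θ≤removed       : θ ℚ.≤ ℕ→ℚ removed
      removed≤L+L     : ℕ→ℚ removed ℚ.≤ L ℚ.+ L
      few-small-parts : FewSmallComponents (diffV (diffE E (Subtree.EQ Q))) (diffE E (Subtree.EQ Q)) Δ L

  private
    suc≤2* : suc Δ ≤ 2 * Δ
    suc≤2* = ≤-trans (m≤m+n (suc Δ) Δ′)
                     (≤-reflexive (solve 1 (λ d → (con 2 :+ d) :+ d := con 2 :* (con 1 :+ d)) refl Δ′))
      where open +-*-Solver

    θ≤L : θ ℚ.≤ L
    θ≤L = ≤+⇒-≤ (ℚ.≤-trans (ℚ.≤-reflexive (sym (ℚ.+-identityʳ L))) (ℚ.+-monoʳ-≤ L (ℕ→ℚ-nonNeg (2 * Δ))))

  open PrefixSums 0≤L θ≤L using (Between; prefix-sum-between)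

  split-below : ∀ v → L ℚ.< ℕ→ℚ (size v) → (∀ {c} → c childOf v → ℕ→ℚ (size c) ℚ.≤ L) → Split
  split-below v v-heavy children-light = prune (prefix-sum-between gains gains-light θ≤gains)
    where
    properSize : Fin n → ℕ
    properSize c = count (properSubtree c)

    gains : List ℕ
    gains = map properSize (children v)

    gains-light : All (λ a → ℕ→ℚ a ℚ.≤ L) gains
    gains-light = map⁺ (All.tabulate λ {c} c∈ →
      ℚ.≤-trans (ℕ→ℚ-mono-≤ {properSize c} {size c} (properSize≤size c)) (children-light (children-childOf c∈)))
      where
      properSize≤size : ∀ c → properSize c ≤ size c
      properSize≤size c = ≤-trans (Data.Nat.Properties.n≤1+n _) (≤-reflexive (sym (size≡suc-properSubtree c)))

    size≤gains+2Δ : size v ≤ sum gains + 2 * Δ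
    size≤gains+2Δ = begin
      size v
        ≡⟨ size-children v ⟩
      suc (sum (map size (children v)))
        ≡⟨ cong (suc ∘ sum) (map-cong size≡suc-properSubtree (children v)) ⟩
      suc (sum (map (suc ∘ properSize) (children v)))
        ≡⟨ cong suc (sum-map-suc properSize (children v)) ⟩
      suc (sum gains + length (children v))
        ≡⟨ +-suc (sum gains) (length (children v)) ⟨
      sum gains + suc (length (children v))
        ≤⟨ +-monoʳ-≤ (sum gains) (≤-trans (s≤s (length-children deg v)) suc≤2*) ⟩
      sum gains + 2 * Δ
        ∎
      where open Data.Nat.Properties.≤-Reasoning

    θ≤gains : θ ℚ.≤ ℕ→ℚ (sum gains)
    θ≤gains = ≤+⇒-≤ (ℚ.≤-trans (ℚ.<⇒≤ v-heavy)
                      (ℚ.≤-trans (ℕ→ℚ-mono-≤ {size v} {sum gains + 2 * Δ} size≤gains+2Δ)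
                                 (ℚ.≤-reflexive (ℕ→ℚ-+ (sum gains) (2 * Δ)))))

    prune : (∃ λ j → Between (sum (take j gains))) → Split
    prune (j , between) = record
      { Q               = Q
      ; removed         = count removed
      ; kept+removed≡n  = count-kept+removed
      ; θ≤removed       = proj₁ removed-between
      ; removed≤L+L     = proj₂ removed-between
      ; few-small-parts = few-small-components Δ′ chosen-length 0≤L
                            (children-light ∘ children-childOf ∘ chosen⊆children)
      }
      where
      chosen⊆children : ∀ {c} → c ∈ take j (children v) → c ∈ children v
      chosen⊆children = lookup (take-⊆ j (children v))

      chosen-length : length (take j (children v)) ≤ Δ
      chosen-length = ≤-trans (≤-reflexive (length-take j (children v)))
                              (≤-trans (Data.Nat.Properties.m⊓n≤n j _) (length-children deg v))

      open Pruning Tr (take j (children v)) (children-childOf ∘ chosen⊆children)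
                      (Unique.take⁺ j (children-unique v))

      removed-between : Between (count removed)
      removed-between = subst Between (trans (cong sum (take-map j (children v))) (sym count-removed)) between

  heavy-vertex-with-light-children : L ℚ.< ℕ→ℚ n →
    ∃ λ v → L ℚ.< ℕ→ℚ (size v) × (∀ {c} → c childOf v → ℕ→ℚ (size c) ℚ.≤ L)
  heavy-vertex-with-light-children L<n =
    light-children (minimal-witness (λ w → L ℚ.<? ℕ→ℚ (size w)) size (root , root-heavy))
    where
    root-heavy : L ℚ.< ℕ→ℚ (size root)
    root-heavy = subst (λ m → L ℚ.< ℕ→ℚ m)
      (sym (count-all {n} {subtree root} λ w → Equivalence.from T-subtree (root∈rootPath w))) L<n
    light-children : (∃ λ v → L ℚ.< ℕ→ℚ (size v) × (∀ w → L ℚ.< ℕ→ℚ (size w) → size v ≤ size w)) →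
      ∃ λ v → L ℚ.< ℕ→ℚ (size v) × (∀ {c} → c childOf v → ℕ→ℚ (size c) ℚ.≤ L)
    light-children (v , v-heavy , v-minimal) = v , v-heavy , λ {c} c◃v → ℚ.≮⇒≥ λ c-heavy →
      <-irrefl refl (<-≤-trans (childOf-size< c◃v) (v-minimal c c-heavy))

  balanced-split : L ℚ.< ℕ→ℚ n → Split
  balanced-split L<n = split-at (heavy-vertex-with-light-children L<n)
    where
    split-at : (∃ λ v → L ℚ.< ℕ→ℚ (size v) × (∀ {c} → c childOf v → ℕ→ℚ (size c) ℚ.≤ L)) → Split
    split-at (v , v-heavy , children-light) = split-below v v-heavy children-light

open import Data.Nat using (zero; _≤_; >-nonZero⁻¹)
open import Data.Fin.Properties using (nonZeroIndex)
open import Data.Product using (Σ; _×_; _,_)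
open import Data.Rational using (ℚ; 0ℚ; 1ℚ; _+_; _-_; _*_; _<_) renaming (_≤_ to _≤ℚ_)
open import Relation.Binary.PropositionalEquality using (_≡_; sym; trans; cong)

lemma7p1 : (Δ : ℕ) → 1 ≤ Δ → (λ' : ℚ) → 0ℚ ≤ℚ λ' → λ' < 1ℚ →
    (n : ℕ) (Tr : RootedTree n) → MaxDegree≤ (RootedTree.E Tr) Δ →
    Σ (Subtree Tr) λ Q →
      ((1ℚ - ℕ→ℚ 2 * λ') * ℕ→ℚ n ≤ℚ ℕ→ℚ (count (Subtree.VQ Q))) ×
      (ℕ→ℚ (count (Subtree.VQ Q)) ≤ℚ (1ℚ - λ') * ℕ→ℚ n + ℕ→ℚ (2 Data.Nat.* Δ)) ×
      FewSmallComponents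
        (diffV (diffE (RootedTree.E Tr) (Subtree.EQ Q)))
        (diffE (RootedTree.E Tr) (Subtree.EQ Q)) Δ (λ' * ℕ→ℚ n)
lemma7p1 zero     ()
lemma7p1 (suc Δ′) _ λ' 0≤λ λ<1 n Tr deg = Q , lower , upper , few-small-parts
  where
  open NatToRational
  open RationalArithmetic
  open BalancedSplit Tr deg (0≤* 0≤λ (ℕ→ℚ-nonNeg n))

  λn<n : λ' * ℕ→ℚ n < ℕ→ℚ n
  λn<n = *<-self λ<1 (ℕ→ℚ-mono-< {0} {n} (>-nonZero⁻¹ n {{nonZeroIndex (RootedTree.root Tr)}}))

  open Split (balanced-split λn<n)

  kept+removed : ℕ→ℚ (count (Subtree.VQ Q)) + ℕ→ℚ removed ≡ ℕ→ℚ n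
  kept+removed = trans (sym (ℕ→ℚ-+ (count (Subtree.VQ Q)) removed)) (cong ℕ→ℚ kept+removed≡n)

  lower : (1ℚ - ℕ→ℚ 2 * λ') * ℕ→ℚ n ≤ℚ ℕ→ℚ (count (Subtree.VQ Q))
  lower = complement-lower {λ'} kept+removed removed≤L+L

  upper : ℕ→ℚ (count (Subtree.VQ Q)) ≤ℚ (1ℚ - λ') * ℕ→ℚ n + ℕ→ℚ (2 Data.Nat.* suc Δ′)
  upper = complement-upper {λ'} kept+removed θ≤removed
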